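{- Every oriented hypergraph has an algebraic spanning tree over the reals.
   Context: An oriented hypergraph $H=(V,E)$ consists of a finite set $V$ and a set $E$ of ordered pairs $(A,B)$ of disjoint subsets of $V$, where $E$ never contains both $(A,B)$ and $(B,A)$. With real coefficients, $C_0,C_1$ are the real vector spaces with bases $V$, $E$; $\partial_1\colon C_1\to C_0$ is the linear extension of $(A,B)\mapsto\sum_{v\in B}v-\sum_{v\in A}v$; $C^0=\mathrm{Hom}(C_0,\mathbb R)$, $C^1=\mathrm{Hom}(C_1,\mathbb R)$; $\delta^0\colon C^0\to C^1$, $\varphi\mapsto\varphi\circ\partial_1$; $\gamma_1\colon C_1\to C^1$ is the isomorphism with $\gamma_1(e)(e')=\delta_{ee'}$ for $e,e'\in E$. Let $\langle\,,\rangle$ be the inner product on $C_1$ for which $E$ is orthonormal. Put $\mathcal C:=\operatorname{Ker}\partial_1$ and $\mathcal B:=\gamma_1^{ -1}(\operatorname{Im}\delta^0)$. A subset $T\subseteq E$ is an algebraic spanning tree (over the reals) if (1) $\mathcal B$ has a basis $(x_t\mid t\in T)$ with $\langle x_t,t'\rangle=\delta_{tt'}$ for all $t,t'\in T$, and (2) $\mathcal C$ has a basis $(x_e\mid e\in E\setminus T)$ with $\langle x_e,e'\rangle=\delta_{ee'}$ for all $e,e'\in E\setminus T$. -}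

module Defs where

open import Level using (Level; _⊔_) renaming (suc to lsuc)
open import Data.Nat using (ℕ) renaming (zero to nzero; suc to nsuc)
open import Data.Fin using (Fin; zero; suc)
open import Data.Fin.Properties using () renaming (_≟_ to _≟ᶠ_)
open import Data.Fin.Subset using (Subset; _∈_; _∉_)
open import Data.Bool using (Bool; true; false; if_then_else_)
open import Data.Sum using (_⊎_)
open import Data.Product using (_×_; _,_; Σ; ∃; ∃-syntax; proj₁; proj₂; swap)
open import Relation.Nullary using (¬_; Dec; yes; no)
open import Relation.Binary.PropositionalEquality using (_≡_; _≢_)
open import Algebra.Structures using (IsCommutativeRing)
open import Relation.Binary.Structures using (IsStrictTotalOrder)

_≤[_,_]_ : ∀ {c ℓ} {A : Set c} → A → (A → A → Set ℓ) → (A → A → Set ℓ) → A → Set ℓ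
x ≤[ _<_ , _≈_ ] y = (x < y) ⊎ (x ≈ y)

-- The real numbers, axiomatised as a (Dedekind-)complete ordered field.
-- Any model of this record is (isomorphic to) ℝ; the theorem is stated
-- for an arbitrary such model.

record RealField (c ℓ : Level) : Set (lsuc (c ⊔ ℓ)) where
  infixl 7 _*_
  infixl 6 _+_
  infix  4 _≈_ _<_
  field
    Carrier : Set c
    _≈_     : Carrier → Carrier → Set ℓ
    _+_     : Carrier → Carrier → Carrier
    _*_     : Carrier → Carrier → Carrier
    -_      : Carrier → Carrier
    0#      : Carrier
    1#      : Carrier
    _<_     : Carrier → Carrier → Set ℓ
    isCommutativeRing : IsCommutativeRing _≈_ _+_ _*_ -_ 0# 1#
    0≉1     : ¬ (0# ≈ 1#)
    inverse : ∀ x → ¬ (x ≈ 0#) → ∃[ y ] (x * y ≈ 1#)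
    isStrictTotalOrder : IsStrictTotalOrder _≈_ _<_
    +-mono-< : ∀ {x y} z → x < y → x + z < y + z
    *-pos    : ∀ {x y} → 0# < x → 0# < y → 0# < x * y
    sup : (P : Carrier → Set c) → ∃[ a ] P a → ∃[ b ] (∀ a → P a → a ≤[ _<_ , _≈_ ] b) →
          ∃[ s ] ((∀ a → P a → a ≤[ _<_ , _≈_ ] s) ×
                 (∀ b → (∀ a → P a → a ≤[ _<_ , _≈_ ] b) → s ≤[ _<_ , _≈_ ] b))

-- Oriented hypergraphs on the vertex set Fin n with m edges.
-- An edge is an ordered pair (A , B) of disjoint subsets of the vertices.

Edge : ℕ → Set
Edge n = Subset n × Subset n

Disjoint : ∀ {n} → Subset n → Subset n → Set
Disjoint A B = ∀ v → v ∈ A → v ∈ B → Data.Empty.⊥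
  where import Data.Empty

record OrientedHypergraph (n m : ℕ) : Set where
  field
    edge     : Fin m → Edge n
    -- E is a set: distinct indices give distinct edges
    injective : ∀ i j → edge i ≡ edge j → i ≡ j
    disjoint : ∀ i → Disjoint (proj₁ (edge i)) (proj₂ (edge i))
    noReverse : ∀ i j → edge i ≢ swap (edge j)

module LinearAlgebra {c ℓ} (R : RealField c ℓ) where
  open RealField R

  Σ[_] : ∀ {k} → (Fin k → Carrier) → Carrier
  Σ[_] {nzero}  f = 0#
  Σ[_] {nsuc k} f = f zero + Σ[ (λ i → f (suc i)) ]

  δ : ∀ {k} → Fin k → Fin k → Carrier
  δ i j with i ≟ᶠ j
  ... | yes _ = 1#
  ... | no  _ = 0#

  -- Elements of C_0 (basis V = Fin n) and C_1 (basis E = Fin m),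
  -- represented by their coordinate vectors.
  C₀ : ℕ → Set c
  C₀ n = Fin n → Carrier

  C₁ : ℕ → Set c
  C₁ m = Fin m → Carrier

  -- C^0 = Hom(C_0, ℝ) and C^1 = Hom(C_1, ℝ), a linear functional being
  -- determined by (and represented by) its values on the basis.
  C⁰ : ℕ → Set c
  C⁰ n = Fin n → Carrier

  C¹ : ℕ → Set c
  C¹ m = Fin m → Carrier

  evalC⁰ : ∀ {n} → C⁰ n → C₀ n → Carrier
  evalC⁰ φ x = Σ[ (λ v → φ v * x v) ]

  boundaryCoeff : ∀ {n} → Edge n → Fin n → Carrier
  boundaryCoeff (A , B) v =
    (if Data.Vec.lookup B v then 1# else 0#) + - (if Data.Vec.lookup A v then 1# else 0#)
    where import Data.Vec

  module _ {n m} (H : OrientedHypergraph n m) where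
    open OrientedHypergraph H

    basis₁ : Fin m → C₁ m
    basis₁ e = δ e

    -- ∂₁ : C₁ → C₀, linear extension of (A , B) ↦ Σ_{v∈B} v − Σ_{v∈A} v
    ∂₁ : C₁ m → C₀ n
    ∂₁ x v = Σ[ (λ e → x e * boundaryCoeff (edge e) v) ]

    -- δ⁰ φ = φ ∘ ∂₁, recorded by its values on the basis E of C_1
    δ⁰ : C⁰ n → C¹ m
    δ⁰ φ e = evalC⁰ φ (∂₁ (basis₁ e))

    -- γ₁ : C₁ → C¹ with γ₁(e)(e') = δ_{ee'}; its inverse on coordinates
    γ₁ : C₁ m → C¹ m
    γ₁ x e' = Σ[ (λ e → x e * δ e e') ]

    _≋_ : C₁ m → C₁ m → Set ℓ
    x ≋ y = ∀ e → x e ≈ y e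

    ⟨_,_⟩ : C₁ m → C₁ m → Carrier
    ⟨ x , y ⟩ = Σ[ (λ e → x e * y e) ]

    InCycles : C₁ m → Set ℓ
    InCycles x = ∀ v → ∂₁ x v ≈ 0#

    InCocycles : C₁ m → Set (c ⊔ ℓ)
    InCocycles x = ∃[ φ ] (∀ e → γ₁ x e ≈ δ⁰ φ e)

    combo : Subset m → (Fin m → Carrier) → (Fin m → C₁ m) → C₁ m
    combo S a x e' =
      Σ[ (λ e → if Data.Vec.lookup S e then a e * x e e' else 0#) ]
      where import Data.Vec

    IsBasisOf : (C₁ m → Set (c ⊔ ℓ)) → Subset m → (Fin m → C₁ m) → Set (c ⊔ ℓ)
    IsBasisOf P S x =
      (∀ e → e ∈ S → P (x e)) ×
      (∀ a → combo S a x ≋ (λ _ → 0#) → ∀ e → e ∈ S → a e ≈ 0#) ×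
      (∀ y → P y → ∃[ a ] (y ≋ combo S a x))

    compl : Subset m → Subset m
    compl = Data.Fin.Subset.∁
      where import Data.Fin.Subset

    IsAlgebraicSpanningTree : Subset m → Set (c ⊔ ℓ)
    IsAlgebraicSpanningTree T =
      (∃[ x ] (IsBasisOf InCocycles T x ×
               (∀ t t' → t ∈ T → t' ∈ T → ⟨ x t , basis₁ t' ⟩ ≈ δ t t'))) ×
      (∃[ x ] (IsBasisOf (λ y → Level.Lift c (InCycles y)) (compl T) x ×
               (∀ e e' → e ∈ compl T → e' ∈ compl T → ⟨ x e , basis₁ e' ⟩ ≈ δ e e')))

module Submission where

-- Over any field with decidable equality, Gauss–Jordan elimination of the incidence
-- matrix r (r v e = coefficient of v in ∂₁ e) produces pivot columns T and rows x_t
-- (t ∈ T) of the row space with x_t(t') = δ_tt' for t' ∈ T, in which every row of r,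
-- hence every vector of the row space, expands with its own values on T as coordinates.
-- The row space is ℬ, since δ⁰ φ has coordinates Σ_v φ_v r_v. For e ∉ T the vectors
-- x_e = e − Σ_{t ∈ T} x_t(e) t lie in the kernel 𝒞 of r, and as 𝒞 is orthogonal to the
-- row space, a vector of 𝒞 is determined by its values off T and expands in the x_e.
-- Both families are unitriangular with respect to T, resp. E ∖ T, which gives their
-- independence and ⟨x_t, t'⟩ = δ_tt'.

open import Defs
open import Level using (Level; _⊔_; Lift; lift)
open import Algebra.Bundles using (CommutativeRing)
open import Data.Nat.Base as ℕ using (ℕ; zero; suc)
import Data.Nat.Properties as ℕ
open import Data.Integer.Base as ℤ using (ℤ; +_; -[1+_]; _⊖_)
import Data.Integer.Properties as ℤ
import Data.Sign.Base as Sign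
open import Data.Fin.Base using (Fin; zero; suc)
open import Data.Fin.Properties using (all?; ¬∀⟶∃¬) renaming (_≟_ to _≟ᶠ_)
open import Data.Fin.Subset using (Subset; _∈_)
open import Data.Bool.Base using (Bool; true; false; if_then_else_; _∨_; not)
open import Data.Maybe.Base as Maybe using (Maybe)
open import Data.Product using (∃; ∃-syntax; _,_; proj₁; proj₂)
open import Data.Vec.Base using (lookup; tabulate)
open import Data.Vec.Properties using ([]=⇒lookup; lookup∘tabulate; lookup-map)
open import Function.Base using (_∘_)
open import Relation.Nullary using (¬_; does; yes; no)
open import Relation.Binary.Definitions using (Decidable)
open import Relation.Binary.Structures using (IsStrictTotalOrder)
open import Relation.Binary.Consequences using (dec⇒weaklyDec)
open import Relation.Binary.PropositionalEquality as ≡ using (_≡_)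
open import Algebra.Solver.Ring.AlmostCommutativeRing
  using (fromCommutativeRing; _-Raw-AlmostCommutative⟶_)
import Algebra.Solver.Ring as RingSolver
import Algebra.Properties.Ring as RingProperties
import Algebra.Properties.CommutativeSemigroup as CommutativeSemigroupProperties
import Algebra.Properties.Semiring.Mult as SemiringMult
import Algebra.Properties.Semiring.Sum as SemiringSum
import Relation.Binary.Reasoning.Setoid as SetoidReasoning

-- The ring solver compares normal forms by reduction, so its coefficients must compute;
-- ℤ, mapped into R by n ↦ n × 1#, provides such coefficients.
module IntegerCoefficients {c ℓ} (R : CommutativeRing c ℓ) where
  open CommutativeRing R
  open RingProperties ring
  open SemiringMult semiring using (_×_; ×-homo-+; ×1-homo-*)
  open SetoidReasoning setoid

  ⟦_⟧ : ℤ → Carrier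
  ⟦ + n ⟧      = n × 1#
  ⟦ -[1+ n ] ⟧ = - (suc n × 1#)

  ⟦-⟧ : ∀ i → ⟦ ℤ.- i ⟧ ≈ - ⟦ i ⟧
  ⟦-⟧ (+ zero)  = sym -0#≈0#
  ⟦-⟧ (+ suc n) = refl
  ⟦-⟧ -[1+ n ]  = sym (-‿involutive _)

  1+a-[1+b]≈a-b : ∀ a b → (1# + a) - (1# + b) ≈ a - b
  1+a-[1+b]≈a-b a b = begin
    (1# + a) - (1# + b)       ≈⟨ +-cong (+-comm 1# a) (-‿anti-homo-+ 1# b) ⟩
    (a + 1#) + (- b + - 1#)   ≈⟨ +-congˡ (+-comm (- b) (- 1#)) ⟩
    (a + 1#) + (- 1# + - b)   ≈⟨ +-assoc a 1# _ ⟩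
    a + (1# + (- 1# + - b))   ≈⟨ +-congˡ (sym (+-assoc 1# (- 1#) (- b))) ⟩
    a + ((1# - 1#) + - b)     ≈⟨ +-congˡ (+-congʳ (-‿inverseʳ 1#)) ⟩
    a + (0# + - b)            ≈⟨ +-congˡ (+-identityˡ (- b)) ⟩
    a - b                     ∎

  ⟦⊖⟧ : ∀ m n → ⟦ m ⊖ n ⟧ ≈ m × 1# - n × 1#
  ⟦⊖⟧ zero    zero    = sym (-‿inverseʳ 0#)
  ⟦⊖⟧ zero    (suc n) = sym (+-identityˡ _)
  ⟦⊖⟧ (suc m) zero    = sym (trans (+-congˡ -0#≈0#) (+-identityʳ _))
  ⟦⊖⟧ (suc m) (suc n) = begin
    ⟦ suc m ⊖ suc n ⟧          ≡⟨ ≡.cong ⟦_⟧ (ℤ.[1+m]⊖[1+n]≡m⊖n m n) ⟩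
    ⟦ m ⊖ n ⟧                  ≈⟨ ⟦⊖⟧ m n ⟩
    m × 1# - n × 1#            ≈⟨ 1+a-[1+b]≈a-b _ _ ⟨
    suc m × 1# - suc n × 1#    ∎

  ⟦+⟧ : ∀ i j → ⟦ i ℤ.+ j ⟧ ≈ ⟦ i ⟧ + ⟦ j ⟧
  ⟦+⟧ (+ m)    (+ n)    = ×-homo-+ 1# m n
  ⟦+⟧ (+ m)    -[1+ n ] = ⟦⊖⟧ m (suc n)
  ⟦+⟧ -[1+ m ] (+ n)    = trans (⟦⊖⟧ n (suc m)) (+-comm _ _)
  ⟦+⟧ -[1+ m ] -[1+ n ] = begin
    - (suc (suc m ℕ.+ n) × 1#)          ≡⟨ ≡.cong (λ k → - (suc k × 1#)) (ℕ.+-suc m n) ⟨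
    - ((suc m ℕ.+ suc n) × 1#)          ≈⟨ -‿cong (×-homo-+ 1# (suc m) (suc n)) ⟩
    - (suc m × 1# + suc n × 1#)         ≈⟨ -‿+-comm _ _ ⟨
    - (suc m × 1#) + - (suc n × 1#)     ∎

  ◃-+ : ∀ k → ⟦ Sign.+ ℤ.◃ k ⟧ ≈ k × 1#
  ◃-+ zero    = refl
  ◃-+ (suc k) = refl

  ◃-- : ∀ k → ⟦ Sign.- ℤ.◃ k ⟧ ≈ - (k × 1#)
  ◃-- zero    = sym -0#≈0#
  ◃-- (suc k) = refl

  ⟦*⟧ : ∀ i j → ⟦ i ℤ.* j ⟧ ≈ ⟦ i ⟧ * ⟦ j ⟧
  ⟦*⟧ (+ m)    (+ n)    = trans (◃-+ (m ℕ.* n)) (×1-homo-* m n)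
  ⟦*⟧ (+ m)    -[1+ n ] = trans (◃-- (m ℕ.* suc n)) (trans (-‿cong (×1-homo-* m (suc n))) (-‿distribʳ-* _ _))
  ⟦*⟧ -[1+ m ] (+ n)    = trans (◃-- (suc m ℕ.* n)) (trans (-‿cong (×1-homo-* (suc m) n)) (-‿distribˡ-* _ _))
  ⟦*⟧ -[1+ m ] -[1+ n ] = begin
    (suc m ℕ.* suc n) × 1#             ≈⟨ ×1-homo-* (suc m) (suc n) ⟩
    suc m × 1# * suc n × 1#            ≈⟨ -‿involutive _ ⟨
    - - (suc m × 1# * suc n × 1#)      ≈⟨ -‿cong (-‿distribˡ-* _ _) ⟩
    - (- (suc m × 1#) * suc n × 1#)    ≈⟨ -‿distribʳ-* _ _ ⟩
    - (suc m × 1#) * - (suc n × 1#)    ∎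

  homomorphism : ℤ.+-*-rawRing -Raw-AlmostCommutative⟶ fromCommutativeRing R
  homomorphism = record
    { ⟦_⟧ = ⟦_⟧ ; +-homo = ⟦+⟧ ; *-homo = ⟦*⟧ ; -‿homo = ⟦-⟧
    ; 0-homo = refl ; 1-homo = +-identityʳ 1# }

  ⟦⟧-≟ : ∀ i j → Maybe (⟦ i ⟧ ≈ ⟦ j ⟧)
  ⟦⟧-≟ i j = Maybe.map (λ i≡j → reflexive (≡.cong ⟦_⟧ i≡j)) (dec⇒weaklyDec ℤ._≟_ i j)

  open RingSolver ℤ.+-*-rawRing (fromCommutativeRing R) homomorphism ⟦⟧-≟
    public using (solve; _:=_; _:+_; _:-_; _:*_; :-_; con)

record IsDiscreteField {c ℓ} (F : CommutativeRing c ℓ) : Set (c ⊔ ℓ) where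
  open CommutativeRing F
  field
    _≟_     : Decidable _≈_
    inverse : ∀ x → ¬ x ≈ 0# → ∃[ y ] x * y ≈ 1#

module RowReduction {c ℓ} (F : CommutativeRing c ℓ) (discrete : IsDiscreteField F) where

  open CommutativeRing F hiding (zero)
  open IsDiscreteField discrete
  open RingProperties ring using (-0#≈0#; -‿+-comm; -1*x≈-x; x∙y⁻¹≈ε⇒x≈y; +-inverseˡ-unique)
  open SemiringSum semiring
    using (sum; sum-cong-≋; sum-replicate-zero; ∑-distrib-+; ∑-comm; *-distribˡ-sum; *-distribʳ-sum)
  open CommutativeSemigroupProperties *-commutativeSemigroup using (x∙yz≈y∙xz)
  open IntegerCoefficients F
  open SetoidReasoning setoid

  -- Unlike LinearAlgebra.δ, which is defined by `with`, this one reduces on constructors.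
  δ : ∀ {k} → Fin k → Fin k → Carrier
  δ i j = if does (i ≟ᶠ j) then 1# else 0#

  δ-sym : ∀ {k} (i j : Fin k) → δ i j ≡ δ j i
  δ-sym zero    zero    = ≡.refl
  δ-sym zero    (suc j) = ≡.refl
  δ-sym (suc i) zero    = ≡.refl
  δ-sym (suc i) (suc j) = δ-sym i j

  sum-zero : ∀ {k} {f : Fin k → Carrier} → (∀ i → f i ≈ 0#) → sum f ≈ 0#
  sum-zero {k} f≈0 = trans (sum-cong-≋ f≈0) (sum-replicate-zero k)

  sum-*δ : ∀ {k} (f : Fin k → Carrier) i → sum (λ j → f j * δ j i) ≈ f i
  sum-*δ f zero = begin
    f zero * 1# + sum (λ j → f (suc j) * 0#)  ≈⟨ +-cong (*-identityʳ _) (sum-zero (λ j → zeroʳ (f (suc j)))) ⟩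
    f zero + 0#                               ≈⟨ +-identityʳ _ ⟩
    f zero                                    ∎
  sum-*δ f (suc i) = trans (+-cong (zeroʳ _) (sum-*δ (f ∘ suc) i)) (+-identityˡ _)

  sum-δ* : ∀ {k} (f : Fin k → Carrier) i → sum (λ j → δ i j * f j) ≈ f i
  sum-δ* f i = trans (sum-cong-≋ (λ j → trans (*-comm _ _) (reflexive (≡.cong (f j *_) (δ-sym i j))))) (sum-*δ f i)

  -‿sum : ∀ {k} (f : Fin k → Carrier) → - sum f ≈ sum (λ i → - f i)
  -‿sum {zero}  f = -0#≈0#
  -‿sum {suc k} f = trans (sym (-‿+-comm _ _)) (+-congˡ (-‿sum (f ∘ suc)))

  InSpan : ∀ {n m} → (Fin n → Fin m → Carrier) → (Fin m → Carrier) → Set (c ⊔ ℓ)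
  InSpan {n} r y = ∃ λ (φ : Fin n → Carrier) → ∀ e → y e ≈ sum (λ v → φ v * r v e)

  InKernel : ∀ {n m} → (Fin n → Fin m → Carrier) → (Fin m → Carrier) → Set ℓ
  InKernel r y = ∀ v → sum (λ e → y e * r v e) ≈ 0#

  module _ {n m} (r : Fin n → Fin m → Carrier) where

    span-resp : ∀ {y z} → (∀ e → y e ≈ z e) → InSpan r y → InSpan r z
    span-resp y≈z (φ , y≈φr) = φ , λ e → trans (sym (y≈z e)) (y≈φr e)

    span-0 : InSpan r (λ _ → 0#)
    span-0 = (λ _ → 0#) , λ e → sym (sum-zero (λ v → zeroˡ (r v e)))

    span-+ : ∀ {y z} → InSpan r y → InSpan r z → InSpan r (λ e → y e + z e)
    span-+ {y} {z} (φ , y≈φr) (ψ , z≈ψr) = (λ v → φ v + ψ v) , λ e → begin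
      y e + z e                                             ≈⟨ +-cong (y≈φr e) (z≈ψr e) ⟩
      sum (λ v → φ v * r v e) + sum (λ v → ψ v * r v e)     ≈⟨ ∑-distrib-+ (λ v → φ v * r v e) _ ⟨
      sum (λ v → φ v * r v e + ψ v * r v e)                 ≈⟨ sum-cong-≋ (λ v → distribʳ (r v e) (φ v) (ψ v)) ⟨
      sum (λ v → (φ v + ψ v) * r v e)                       ∎

    span-* : ∀ a {y} → InSpan r y → InSpan r (λ e → a * y e)
    span-* a {y} (φ , y≈φr) = (λ v → a * φ v) , λ e → begin
      a * y e                            ≈⟨ *-congˡ (y≈φr e) ⟩
      a * sum (λ v → φ v * r v e)        ≈⟨ *-distribˡ-sum a (λ v → φ v * r v e) ⟩
      sum (λ v → a * (φ v * r v e))      ≈⟨ sum-cong-≋ (λ v → *-assoc a (φ v) (r v e)) ⟨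
      sum (λ v → a * φ v * r v e)        ∎

    span-row : ∀ v → InSpan r (r v)
    span-row v = δ v , λ e → sym (sum-δ* (λ u → r u e) v)

    span-∑ : ∀ {k} (a : Fin k → Carrier) (y : Fin k → Fin m → Carrier) →
             (∀ t → InSpan r (y t)) → InSpan r (λ e → sum (λ t → a t * y t e))
    span-∑ {zero}  a y y∈span = span-0
    span-∑ {suc k} a y y∈span =
      span-+ (span-* (a zero) (y∈span zero)) (span-∑ (a ∘ suc) (y ∘ suc) (y∈span ∘ suc))

  span-extend : ∀ {n m} (r : Fin (suc n) → Fin m → Carrier) {y} → InSpan (r ∘ suc) y → InSpan r y
  span-extend r (φ , y≈φr) = (λ { zero → 0# ; (suc v) → φ v }) , λ e →
    trans (y≈φr e) (sym (trans (+-congʳ (zeroˡ _)) (+-identityˡ _)))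

  record RowReduced {n m} (r : Fin n → Fin m → Carrier) : Set (c ⊔ ℓ) where
    field
      pivot           : Fin m → Bool
      row             : Fin m → Fin m → Carrier
      row∈span        : ∀ t → InSpan r (row t)
      row-nonpivot≈0  : ∀ t → pivot t ≡ false → ∀ e → row t e ≈ 0#
      row-at-pivot≈δ  : ∀ t t' → pivot t' ≡ true → row t t' ≈ δ t t'
      expand          : ∀ v e → r v e ≈ sum (λ t → r v t * row t e)

  module AdjoinRow {n m} (r : Fin (suc n) → Fin m → Carrier) (reduced : RowReduced (r ∘ suc)) where
    open RowReduced reduced

    projection : Fin m → Carrier
    projection e = sum (λ t → r zero t * row t e)

    residual : Fin m → Carrier
    residual e = r zero e - projection e

    row∈span′ : ∀ t → InSpan r (row t)
    row∈span′ t = span-extend r (row∈span t)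

    residual∈span : InSpan r residual
    residual∈span = span-+ r (span-row r zero)
      (span-resp r (λ e → -1*x≈-x (projection e)) (span-* r (- 1#) (span-∑ r (r zero) row row∈span′)))

    residual-at-pivot≈0 : ∀ t' → pivot t' ≡ true → residual t' ≈ 0#
    residual-at-pivot≈0 t' pt' = begin
      r zero t' - projection t'
        ≈⟨ +-congˡ (-‿cong (sum-cong-≋ (λ t → *-congˡ (row-at-pivot≈δ t t' pt')))) ⟩
      r zero t' - sum (λ t → r zero t * δ t t')
        ≈⟨ +-congˡ (-‿cong (sum-*δ (r zero) t')) ⟩
      r zero t' - r zero t'
        ≈⟨ -‿inverseʳ _ ⟩
      0# ∎

    adjoin-dependent : (∀ e → residual e ≈ 0#) → RowReduced r
    adjoin-dependent residual≈0 = record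
      { pivot = pivot ; row = row ; row∈span = row∈span′
      ; row-nonpivot≈0 = row-nonpivot≈0 ; row-at-pivot≈δ = row-at-pivot≈δ ; expand = expand′ }
      where
      expand′ : ∀ v e → r v e ≈ sum (λ t → r v t * row t e)
      expand′ zero    e = x∙y⁻¹≈ε⇒x≈y _ _ (residual≈0 e)
      expand′ (suc v) e = expand v e

    module AdjoinPivot (p : Fin m) (residual-p≉0 : ¬ residual p ≈ 0#) where
      residual-p⁻¹ : Carrier
      residual-p⁻¹ = proj₁ (inverse (residual p) residual-p≉0)

      pivotRow : Fin m → Carrier
      pivotRow e = residual-p⁻¹ * residual e

      pivotRow-at-p≈1 : pivotRow p ≈ 1#
      pivotRow-at-p≈1 = trans (*-comm residual-p⁻¹ (residual p)) (proj₂ (inverse (residual p) residual-p≉0))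

      pivotRow-at-pivot≈0 : ∀ t' → pivot t' ≡ true → pivotRow t' ≈ 0#
      pivotRow-at-pivot≈0 t' pt' = trans (*-congˡ (residual-at-pivot≈0 t' pt')) (zeroʳ residual-p⁻¹)

      pivotRow∈span : InSpan r pivotRow
      pivotRow∈span = span-* r residual-p⁻¹ residual∈span

      pivot′ : Fin m → Bool
      pivot′ t = pivot t ∨ does (t ≟ᶠ p)

      -- Clear column p from the old rows and install pivotRow as the row of the new pivot p
      -- (the old row p is zero: p is not a pivot, as the residual vanishes on pivots).
      row′ : Fin m → Fin m → Carrier
      row′ t e = row t e + - row t p * pivotRow e + δ t p * pivotRow e

      row′∈span : ∀ t → InSpan r (row′ t)
      row′∈span t =
        span-+ r (span-+ r (row∈span′ t) (span-* r (- row t p) pivotRow∈span)) (span-* r (δ t p) pivotRow∈span)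

      row′-nonpivot≈0 : ∀ t → pivot′ t ≡ false → ∀ e → row′ t e ≈ 0#
      row′-nonpivot≈0 t h e with pivot t in pt | t ≟ᶠ p
      ... | false | no _ = trans
        (+-congʳ (+-cong (row-nonpivot≈0 t pt e) (*-congʳ (-‿cong (row-nonpivot≈0 t pt p)))))
        (solve 1 (λ y → con (+ 0) :+ :- con (+ 0) :* y :+ con (+ 0) :* y := con (+ 0)) refl (pivotRow e))

      row′-at-pivot≈δ : ∀ t t' → pivot′ t' ≡ true → row′ t t' ≈ δ t t'
      row′-at-pivot≈δ t t' h with pivot t' in pt' | t' ≟ᶠ p
      ... | true | _ = trans
        (+-cong (+-cong (row-at-pivot≈δ t t' pt') (*-congˡ (pivotRow-at-pivot≈0 t' pt')))
                (*-congˡ (pivotRow-at-pivot≈0 t' pt')))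
        (solve 3 (λ d x d′ → d :+ :- x :* con (+ 0) :+ d′ :* con (+ 0) := d) refl (δ t t') (row t p) (δ t p))
      ... | false | yes ≡.refl = begin
        row t p + - row t p * pivotRow p + δ t p * pivotRow p
          ≈⟨ +-cong (+-congˡ (*-pivotRow-at-p (- row t p))) (*-pivotRow-at-p (δ t p)) ⟩
        row t p + - row t p + δ t p
          ≈⟨ +-congʳ (-‿inverseʳ (row t p)) ⟩
        0# + δ t p
          ≈⟨ +-identityˡ (δ t p) ⟩
        δ t p ∎
        where
        *-pivotRow-at-p : ∀ x → x * pivotRow p ≈ x
        *-pivotRow-at-p x = trans (*-congˡ pivotRow-at-p≈1) (*-identityʳ x)

      ∑-row′ : ∀ (a : Fin m → Carrier) e → sum (λ t → a t * row′ t e) ≈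
               sum (λ t → a t * row t e) + - sum (λ t → a t * row t p) * pivotRow e + a p * pivotRow e
      ∑-row′ a e = begin
        sum (λ t → a t * row′ t e)
          ≈⟨ sum-cong-≋ (λ t → solve 5 (λ a x x′ d y → a :* (x :+ :- x′ :* y :+ d :* y)
                                                   := a :* x :+ :- (a :* x′) :* y :+ a :* d :* y)
                                   refl (a t) (row t e) (row t p) (δ t p) (pivotRow e)) ⟩
        sum (λ t → a t * row t e + - (a t * row t p) * pivotRow e + a t * δ t p * pivotRow e)
          ≈⟨ ∑-distrib-+ (λ t → a t * row t e + - (a t * row t p) * pivotRow e) _ ⟩
        sum (λ t → a t * row t e + - (a t * row t p) * pivotRow e) + sum (λ t → a t * δ t p * pivotRow e)
          ≈⟨ +-cong (∑-distrib-+ (λ t → a t * row t e) _) (sym (*-distribʳ-sum (pivotRow e) (λ t → a t * δ t p))) ⟩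
        sum (λ t → a t * row t e) + sum (λ t → - (a t * row t p) * pivotRow e) + sum (λ t → a t * δ t p) * pivotRow e
          ≈⟨ +-cong (+-congˡ (sym (*-distribʳ-sum (pivotRow e) (λ t → - (a t * row t p))))) (*-congʳ (sum-*δ a p)) ⟩
        sum (λ t → a t * row t e) + sum (λ t → - (a t * row t p)) * pivotRow e + a p * pivotRow e
          ≈⟨ +-congʳ (+-congˡ (*-congʳ (-‿sum (λ t → a t * row t p)))) ⟨
        sum (λ t → a t * row t e) + - sum (λ t → a t * row t p) * pivotRow e + a p * pivotRow e
          ∎

      expand′ : ∀ v e → r v e ≈ sum (λ t → r v t * row′ t e)
      expand′ zero e = sym (begin
        sum (λ t → r zero t * row′ t e)
          ≈⟨ ∑-row′ (r zero) e ⟩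
        projection e + - projection p * pivotRow e + r zero p * pivotRow e
          ≈⟨ solve 5 (λ x x′ ρ ρ′ w → x :+ :- x′ :* (w :* (ρ :- x)) :+ ρ′ :* (w :* (ρ :- x))
                                     := x :+ ((ρ′ :- x′) :* w) :* (ρ :- x))
                     refl (projection e) (projection p) (r zero e) (r zero p) residual-p⁻¹ ⟩
        projection e + (residual p * residual-p⁻¹) * residual e
          ≈⟨ +-congˡ (*-congʳ (proj₂ (inverse (residual p) residual-p≉0))) ⟩
        projection e + 1# * residual e
          ≈⟨ +-congˡ (*-identityˡ (residual e)) ⟩
        projection e + (r zero e - projection e)
          ≈⟨ solve 2 (λ x ρ → x :+ (ρ :- x) := ρ) refl (projection e) (r zero e) ⟩
        r zero e ∎)
      expand′ (suc v) e = sym (begin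
        sum (λ t → r (suc v) t * row′ t e)
          ≈⟨ ∑-row′ (r (suc v)) e ⟩
        sum (λ t → r (suc v) t * row t e) + - sum (λ t → r (suc v) t * row t p) * pivotRow e + r (suc v) p * pivotRow e
          ≈⟨ +-congʳ (+-cong (expand v e) (*-congʳ (-‿cong (expand v p)))) ⟨
        r (suc v) e + - r (suc v) p * pivotRow e + r (suc v) p * pivotRow e
          ≈⟨ solve 3 (λ x x′ y → x :+ :- x′ :* y :+ x′ :* y := x) refl (r (suc v) e) (r (suc v) p) (pivotRow e) ⟩
        r (suc v) e ∎)

      adjoin-pivot : RowReduced r
      adjoin-pivot = record
        { pivot = pivot′ ; row = row′ ; row∈span = row′∈span
        ; row-nonpivot≈0 = row′-nonpivot≈0 ; row-at-pivot≈δ = row′-at-pivot≈δ ; expand = expand′ }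

    adjoin : RowReduced r
    adjoin with all? (λ e → residual e ≟ 0#)
    ... | yes residual≈0 = adjoin-dependent residual≈0
    ... | no residual≉0 with ¬∀⟶∃¬ m _ (λ e → residual e ≟ 0#) residual≉0
    ...   | p , residual-p≉0 = AdjoinPivot.adjoin-pivot p residual-p≉0

  rowReduce : ∀ {n m} (r : Fin n → Fin m → Carrier) → RowReduced r
  rowReduce {zero}  r = record
    { pivot = λ _ → false ; row = λ _ _ → 0# ; row∈span = λ _ → span-0 r
    ; row-nonpivot≈0 = λ _ _ _ → refl ; row-at-pivot≈δ = λ _ _ () ; expand = λ () }
  rowReduce {suc n} r = AdjoinRow.adjoin r (rowReduce (r ∘ suc))

  span⊥kernel : ∀ {n m} {r : Fin n → Fin m → Carrier} {y z} →
                InKernel r y → InSpan r z → sum (λ e → y e * z e) ≈ 0#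
  span⊥kernel {r = r} {y} {z} y∈ker (φ , z≈φr) = begin
    sum (λ e → y e * z e)
      ≈⟨ sum-cong-≋ (λ e → trans (*-congˡ (z≈φr e)) (*-distribˡ-sum (y e) (λ v → φ v * r v e))) ⟩
    sum (λ e → sum (λ v → y e * (φ v * r v e)))
      ≈⟨ ∑-comm (λ e v → y e * (φ v * r v e)) ⟩
    sum (λ v → sum (λ e → y e * (φ v * r v e)))
      ≈⟨ sum-cong-≋ (λ v → sum-cong-≋ (λ e → x∙yz≈y∙xz (y e) (φ v) (r v e))) ⟩
    sum (λ v → sum (λ e → φ v * (y e * r v e)))
      ≈⟨ sum-cong-≋ (λ v → *-distribˡ-sum (φ v) (λ e → y e * r v e)) ⟨
    sum (λ v → φ v * sum (λ e → y e * r v e))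
      ≈⟨ sum-zero (λ v → trans (*-congˡ (y∈ker v)) (zeroʳ (φ v))) ⟩
    0# ∎

  restrict : ∀ {m} → (Fin m → Bool) → (Fin m → Carrier) → Fin m → Carrier
  restrict P a e = if P e then a e else 0#

  restrict-true : ∀ {m} (P : Fin m → Bool) (a : Fin m → Carrier) {e} → P e ≡ true → restrict P a e ≡ a e
  restrict-true P a {e} Pe rewrite Pe = ≡.refl

  module _ {n m} {r : Fin n → Fin m → Carrier} (reduced : RowReduced r) where
    open RowReduced reduced

    nonpivot : Fin m → Bool
    nonpivot = not ∘ pivot

    span-expand : ∀ {y} → InSpan r y → ∀ e' → y e' ≈ sum (λ t → restrict pivot y t * row t e')
    span-expand {y} (φ , y≈φr) e' = begin
      y e'
        ≈⟨ y≈φr e' ⟩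
      sum (λ v → φ v * r v e')
        ≈⟨ sum-cong-≋ (λ v → trans (*-congˡ (expand v e')) (*-distribˡ-sum (φ v) (λ t → r v t * row t e'))) ⟩
      sum (λ v → sum (λ t → φ v * (r v t * row t e')))
        ≈⟨ ∑-comm (λ v t → φ v * (r v t * row t e')) ⟩
      sum (λ t → sum (λ v → φ v * (r v t * row t e')))
        ≈⟨ sum-cong-≋ (λ t → sum-cong-≋ (λ v → *-assoc (φ v) (r v t) (row t e'))) ⟨
      sum (λ t → sum (λ v → φ v * r v t * row t e'))
        ≈⟨ sum-cong-≋ (λ t → *-distribʳ-sum (row t e') (λ v → φ v * r v t)) ⟨
      sum (λ t → sum (λ v → φ v * r v t) * row t e')
        ≈⟨ sum-cong-≋ (λ t → *-congʳ (y≈φr t)) ⟨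
      sum (λ t → y t * row t e')
        ≈⟨ sum-cong-≋ drop-nonpivot ⟩
      sum (λ t → restrict pivot y t * row t e') ∎
      where
      drop-nonpivot : ∀ t → y t * row t e' ≈ restrict pivot y t * row t e'
      drop-nonpivot t with pivot t in pt
      ... | true  = refl
      ... | false = trans (*-congˡ (row-nonpivot≈0 t pt e')) (trans (zeroʳ (y t)) (sym (zeroˡ (row t e'))))

    -- For a non-pivot e, the standard null-space vector of the free column e.
    kernelVector : Fin m → Fin m → Carrier
    kernelVector e e' = δ e e' - row e' e

    kernelVector∈kernel : ∀ e → InKernel r (kernelVector e)
    kernelVector∈kernel e v = begin
      sum (λ e' → (δ e e' - row e' e) * r v e')
        ≈⟨ sum-cong-≋ (λ e' → solve 3 (λ d x ρ → (d :- x) :* ρ := d :* ρ :+ :- (ρ :* x))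
                                      refl (δ e e') (row e' e) (r v e')) ⟩
      sum (λ e' → δ e e' * r v e' + - (r v e' * row e' e))
        ≈⟨ ∑-distrib-+ (λ e' → δ e e' * r v e') _ ⟩
      sum (λ e' → δ e e' * r v e') + sum (λ e' → - (r v e' * row e' e))
        ≈⟨ +-cong (sym (sum-δ* (r v) e)) (-‿sum (λ e' → r v e' * row e' e)) ⟨
      r v e - sum (λ e' → r v e' * row e' e)
        ≈⟨ +-congʳ (expand v e) ⟩
      sum (λ e' → r v e' * row e' e) - sum (λ e' → r v e' * row e' e)
        ≈⟨ -‿inverseʳ _ ⟩
      0# ∎

    kernelVector-at-nonpivot≈δ : ∀ e e' → nonpivot e' ≡ true → kernelVector e e' ≈ δ e e'
    kernelVector-at-nonpivot≈δ e e' _ with pivot e' in pe'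
    ... | false = trans (+-congˡ (trans (-‿cong (row-nonpivot≈0 e' pe' e)) -0#≈0#)) (+-identityʳ (δ e e'))

    ∑-kernelVector : ∀ (b : Fin m → Carrier) e' →
                     sum (λ e → b e * kernelVector e e') ≈ b e' - sum (λ e → b e * row e' e)
    ∑-kernelVector b e' = begin
      sum (λ e → b e * (δ e e' - row e' e))
        ≈⟨ sum-cong-≋ (λ e → solve 3 (λ b d x → b :* (d :- x) := b :* d :+ :- (b :* x))
                                     refl (b e) (δ e e') (row e' e)) ⟩
      sum (λ e → b e * δ e e' + - (b e * row e' e))
        ≈⟨ ∑-distrib-+ (λ e → b e * δ e e') _ ⟩
      sum (λ e → b e * δ e e') + sum (λ e → - (b e * row e' e))
        ≈⟨ +-cong (sym (sum-*δ b e')) (-‿sum (λ e → b e * row e' e)) ⟨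
      b e' - sum (λ e → b e * row e' e) ∎

    kernel-coordinates : ∀ {y} → InKernel r y → ∀ e' →
                         y e' ≈ restrict nonpivot y e' - sum (λ e → restrict nonpivot y e * row e' e)
    kernel-coordinates {y} y∈ker e' with pivot e' in pe'
    ... | false = sym (trans (+-congˡ (trans (-‿cong (sum-zero row-e'≈0)) -0#≈0#)) (+-identityʳ (y e')))
      where
      row-e'≈0 : ∀ e → restrict nonpivot y e * row e' e ≈ 0#
      row-e'≈0 e = trans (*-congˡ (row-nonpivot≈0 e' pe' e)) (zeroʳ _)
    ... | true  = trans (+-inverseˡ-unique (y e') _ y+B≈0) (sym (+-identityˡ _))
      where
      split : ∀ e → y e * row e' e ≈ restrict pivot y e * δ e e' + restrict nonpivot y e * row e' e
      split e with pivot e in pe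
      ... | true  = trans (*-congˡ (trans (row-at-pivot≈δ e' e pe) (reflexive (δ-sym e' e))))
                          (sym (trans (+-congˡ (zeroˡ (row e' e))) (+-identityʳ _)))
      ... | false = sym (trans (+-congʳ (zeroˡ (δ e e'))) (+-identityˡ _))

      y+B≈0 : y e' + sum (λ e → restrict nonpivot y e * row e' e) ≈ 0#
      y+B≈0 = begin
        y e' + sum (λ e → restrict nonpivot y e * row e' e)
          ≡⟨ ≡.cong (_+ sum (λ e → restrict nonpivot y e * row e' e)) (restrict-true pivot y pe') ⟨
        restrict pivot y e' + sum (λ e → restrict nonpivot y e * row e' e)
          ≈⟨ +-congʳ (sum-*δ (restrict pivot y) e') ⟨
        sum (λ e → restrict pivot y e * δ e e') + sum (λ e → restrict nonpivot y e * row e' e)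
          ≈⟨ ∑-distrib-+ (λ e → restrict pivot y e * δ e e') _ ⟨
        sum (λ e → restrict pivot y e * δ e e' + restrict nonpivot y e * row e' e)
          ≈⟨ sum-cong-≋ split ⟨
        sum (λ e → y e * row e' e)
          ≈⟨ span⊥kernel y∈ker (row∈span e') ⟩
        0# ∎

    kernel-expand : ∀ {y} → InKernel r y → ∀ e' → y e' ≈ sum (λ e → restrict nonpivot y e * kernelVector e e')
    kernel-expand y∈ker e' = trans (kernel-coordinates y∈ker e') (sym (∑-kernelVector (restrict nonpivot _) e'))

module AlgebraicSpanningTrees {c ℓ} (R : RealField c ℓ) where
  open RealField R using (Carrier; _≈_; _+_; _*_; 0#; 1#; isCommutativeRing; isStrictTotalOrder; inverse)
  open LinearAlgebra R hiding (δ)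
  open import Data.Product using (_×_)

  commutativeRing : CommutativeRing c ℓ
  commutativeRing = record { isCommutativeRing = isCommutativeRing }

  open CommutativeRing commutativeRing using (setoid; refl; sym; trans; reflexive; *-congˡ; *-congʳ; zeroˡ)
  open SemiringSum (CommutativeRing.semiring commutativeRing) using (sum; sum-cong-≋)
  discreteField : IsDiscreteField commutativeRing
  discreteField = record { _≟_ = IsStrictTotalOrder._≟_ isStrictTotalOrder ; inverse = inverse }

  open RowReduction commutativeRing discreteField public
  open SetoidReasoning setoid

  Σ≡sum : ∀ {k} (f : Fin k → Carrier) → Σ[ f ] ≡ sum f
  Σ≡sum {zero}  f = ≡.refl
  Σ≡sum {suc k} f = ≡.cong (λ s → f zero + s) (Σ≡sum (f ∘ suc))

  Σ≈sum : ∀ {k} {f g : Fin k → Carrier} → (∀ i → f i ≈ g i) → Σ[ f ] ≈ sum g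
  Σ≈sum {f = f} f≈g = trans (reflexive (Σ≡sum f)) (sum-cong-≋ f≈g)

  δ-compat : ∀ {k} (i j : Fin k) → LinearAlgebra.δ R i j ≡ δ i j
  δ-compat i j with i ≟ᶠ j
  ... | yes _ = ≡.refl
  ... | no  _ = ≡.refl

  module _ {n m} (H : OrientedHypergraph n m) where
    open OrientedHypergraph H

    incidence : Fin n → Fin m → Carrier
    incidence v e = boundaryCoeff (edge e) v

    γ₁≈id : ∀ x e' → γ₁ H x e' ≈ x e'
    γ₁≈id x e' = trans (Σ≈sum (λ e → *-congˡ (reflexive (δ-compat e e')))) (sum-*δ x e')

    δ⁰≈φ*incidence : ∀ φ e → δ⁰ H φ e ≈ sum (λ v → φ v * incidence v e)
    δ⁰≈φ*incidence φ e = Σ≈sum (λ v → *-congˡ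
      (trans (Σ≈sum (λ e' → *-congʳ (reflexive (δ-compat e e')))) (sum-δ* (incidence v) e)))

    ⟨-,basis₁⟩ : ∀ x t → ⟨_,_⟩ H x (basis₁ H t) ≈ x t
    ⟨-,basis₁⟩ x t = trans (Σ≈sum (λ e → *-congˡ (reflexive (≡.trans (δ-compat t e) (δ-sym t e))))) (sum-*δ x t)

    combo≈∑restrict : ∀ S a x e' → combo H S a x e' ≈ sum (λ e → restrict (lookup S) a e * x e e')
    combo≈∑restrict S a x e' = Σ≈sum (λ e → if-*ʳ (lookup S e) (a e) (x e e'))
      where
      if-*ʳ : ∀ b u v → (if b then u * v else 0#) ≈ (if b then u else 0#) * v
      if-*ʳ true  u v = refl
      if-*ʳ false u v = sym (zeroˡ v)

    cocycle⇒span : ∀ {y} → InCocycles H y → InSpan incidence y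
    cocycle⇒span {y} (φ , γ₁y≈δ⁰φ) = φ , λ e →
      trans (sym (γ₁≈id y e)) (trans (γ₁y≈δ⁰φ e) (δ⁰≈φ*incidence φ e))

    span⇒cocycle : ∀ {y} → InSpan incidence y → InCocycles H y
    span⇒cocycle {y} (φ , y≈φr) = φ , λ e →
      trans (γ₁≈id y e) (trans (y≈φr e) (sym (δ⁰≈φ*incidence φ e)))

    cycle⇒kernel : ∀ {y} → InCycles H y → InKernel incidence y
    cycle⇒kernel {y} ∂y≈0 v = trans (reflexive (≡.sym (Σ≡sum (λ e → y e * incidence v e)))) (∂y≈0 v)

    kernel⇒cycle : ∀ {y} → InKernel incidence y → InCycles H y
    kernel⇒cycle {y} y∈ker v = trans (reflexive (Σ≡sum (λ e → y e * incidence v e))) (y∈ker v)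

    unitriangular⇒basis :
      ∀ (V : C₁ m → Set (c ⊔ ℓ)) (S : Subset m) (b : Fin m → Bool) (x : Fin m → C₁ m) →
      (∀ e → lookup S e ≡ b e) →
      (∀ e → V (x e)) →
      (∀ e e' → b e' ≡ true → x e e' ≈ δ e e') →
      (∀ y → V y → ∀ e' → y e' ≈ sum (λ e → restrict b y e * x e e')) →
      IsBasisOf H V S x × (∀ t t' → t ∈ S → t' ∈ S → ⟨_,_⟩ H (x t) (basis₁ H t') ≈ LinearAlgebra.δ R t t')
    unitriangular⇒basis V S b x S≡b x∈V x≈δ expansion =
      ((λ e _ → x∈V e) , independent , spanning) , orthonormal
      where
      ∈⇒b : ∀ {e} → e ∈ S → b e ≡ true
      ∈⇒b {e} e∈S = ≡.trans (≡.sym (S≡b e)) ([]=⇒lookup e∈S)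

      combo≈ : ∀ a e' → combo H S a x e' ≈ sum (λ e → restrict b a e * x e e')
      combo≈ a e' = trans (combo≈∑restrict S a x e')
        (sum-cong-≋ (λ e → reflexive (≡.cong (λ β → (if β then a e else 0#) * x e e') (S≡b e))))

      independent : ∀ a → _≋_ H (combo H S a x) (λ _ → 0#) → ∀ e → e ∈ S → a e ≈ 0#
      independent a combo≈0 e' e'∈S = begin
        a e'                                     ≡⟨ restrict-true b a (∈⇒b e'∈S) ⟨
        restrict b a e'                          ≈⟨ sum-*δ (restrict b a) e' ⟨
        sum (λ e → restrict b a e * δ e e')      ≈⟨ sum-cong-≋ (λ e → *-congˡ (x≈δ e e' (∈⇒b e'∈S))) ⟨
        sum (λ e → restrict b a e * x e e')      ≈⟨ combo≈ a e' ⟨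
        combo H S a x e'                         ≈⟨ combo≈0 e' ⟩
        0#                                       ∎

      spanning : ∀ y → V y → ∃[ a ] (_≋_ H y (combo H S a x))
      spanning y y∈V = y , λ e' → trans (expansion y y∈V e') (sym (combo≈ y e'))

      orthonormal : ∀ t t' → t ∈ S → t' ∈ S → ⟨_,_⟩ H (x t) (basis₁ H t') ≈ LinearAlgebra.δ R t t'
      orthonormal t t' _ t'∈S =
        trans (⟨-,basis₁⟩ (x t) t') (trans (x≈δ t t' (∈⇒b t'∈S)) (reflexive (≡.sym (δ-compat t t'))))

    pivots-isAlgebraicSpanningTree : (reduced : RowReduced incidence) →
                                     IsAlgebraicSpanningTree H (tabulate (RowReduced.pivot reduced))
    pivots-isAlgebraicSpanningTree reduced =
        (row , unitriangular⇒basis (InCocycles H) T pivot row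
                 (lookup∘tabulate pivot)
                 (λ t → span⇒cocycle (row∈span t))
                 row-at-pivot≈δ
                 (λ y y∈ℬ → span-expand reduced (cocycle⇒span y∈ℬ)))
      , (kernelVector reduced , unitriangular⇒basis (Lift c ∘ InCycles H) (compl H T) (nonpivot reduced) (kernelVector reduced)
                 (λ e → ≡.trans (lookup-map e not T) (≡.cong not (lookup∘tabulate pivot e)))
                 (λ e → lift (kernel⇒cycle (kernelVector∈kernel reduced e)))
                 (kernelVector-at-nonpivot≈δ reduced)
                 (λ { y (lift y∈𝒞) → kernel-expand reduced (cycle⇒kernel y∈𝒞) }))
      where
      open RowReduced reduced
      T : Subset m
      T = tabulate pivot

theorem6 : ∀ {c ℓ : Level} (R : RealField c ℓ) (n m : ℕ) (H : OrientedHypergraph n m) →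
    ∃[ T ] LinearAlgebra.IsAlgebraicSpanningTree R H T
theorem6 R n m H = _ , pivots-isAlgebraicSpanningTree H (rowReduce (incidence H))
  where open AlgebraicSpanningTrees R
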